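{- In a dagger category $(\mathbb{X},\dagger)$, a map $f: A\to B$ has a generalized compact singular value decomposition if and only if $f$ is Moore-Penrose split.
   Context: Composition is in diagrammatic order. A dagger category is a category with an identity-on-objects contravariant involutive functor $\dagger$ ($f: A\to B$ gives $f^\dagger: B\to A$, $(fg)^\dagger = g^\dagger f^\dagger$, $f^{\dagger\dagger}=f$). Isometry: $s: A\to B$ with $ss^\dagger = 1_A$; coisometry: $r: A \to B$ with $r^\dagger r = 1_B$. A Moore-Penrose inverse of $f: A\to B$ is $f^\circ: B\to A$ with $ff^\circ f = f$, $f^\circ f f^\circ = f^\circ$, $(ff^\circ)^\dagger = ff^\circ$, $(f^\circ f)^\dagger = f^\circ f$. A $\dagger$-idempotent $e: A\to A$ ($ee = e = e^\dagger$) $\dagger$-splits if there is $r: A\to X$ with $rr^\dagger = e$ and $r^\dagger r = 1_X$. The map $f$ is Moore-Penrose split if it has a Moore-Penrose inverse $f^\circ$ and the $\dagger$-idempotents $ff^\circ$ and $f^\circ f$ both $\dagger$-split. A generalized compact singular value decomposition of $f$ is a triple $(r: A\to X, d: X \to Y, s: Y\to B)$ with $r$ a coisometry, $d$ an isomorphism, $s$ an isometry and $f = rds$. -}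

module Defs where

open import Level using (Level; suc; _⊔_)
open import Relation.Binary using (IsEquivalence)
open import Data.Product using (Σ; _×_; ∃-syntax; _,_)

-- A (locally small, setoid-enriched) category, composition in DIAGRAMMATIC order:
-- for f : A ⇒ B and g : B ⇒ C we write  f ⨾ g : A ⇒ C  (the paper's  fg).
record Category (o ℓ e : Level) : Set (suc (o ⊔ ℓ ⊔ e)) where
  infix  4 _≈_
  infixl 9 _⨾_
  field
    Obj   : Set o
    _⇒_   : Obj → Obj → Set ℓ
    _≈_   : ∀ {A B} → A ⇒ B → A ⇒ B → Set e
    id    : ∀ {A} → A ⇒ A
    _⨾_   : ∀ {A B C} → A ⇒ B → B ⇒ C → A ⇒ C
    ≈-equiv : ∀ {A B} → IsEquivalence (_≈_ {A} {B})
    ⨾-resp-≈ : ∀ {A B C} {f f' : A ⇒ B} {g g' : B ⇒ C} →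
               f ≈ f' → g ≈ g' → f ⨾ g ≈ f' ⨾ g'
    assoc    : ∀ {A B C D} {f : A ⇒ B} {g : B ⇒ C} {h : C ⇒ D} →
               (f ⨾ g) ⨾ h ≈ f ⨾ (g ⨾ h)
    identityˡ : ∀ {A B} {f : A ⇒ B} → id ⨾ f ≈ f
    identityʳ : ∀ {A B} {f : A ⇒ B} → f ⨾ id ≈ f

record DaggerCategory (o ℓ e : Level) : Set (suc (o ⊔ ℓ ⊔ e)) where
  field
    category : Category o ℓ e
  open Category category public
  infix 10 _†
  field
    _†       : ∀ {A B} → A ⇒ B → B ⇒ A
    †-resp-≈ : ∀ {A B} {f g : A ⇒ B} → f ≈ g → f † ≈ g †
    †-identity : ∀ {A} → (id {A}) † ≈ id
    †-homomorphism : ∀ {A B C} {f : A ⇒ B} {g : B ⇒ C} → (f ⨾ g) † ≈ g † ⨾ f †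
    †-involutive : ∀ {A B} {f : A ⇒ B} → f † † ≈ f

module _ {o ℓ e : Level} (𝕏 : DaggerCategory o ℓ e) where
  open DaggerCategory 𝕏

  IsIsometry : ∀ {A B} → A ⇒ B → Set e
  IsIsometry s = s ⨾ s † ≈ id

  IsCoisometry : ∀ {A B} → A ⇒ B → Set e
  IsCoisometry r = r † ⨾ r ≈ id

  IsIso : ∀ {X Y} → X ⇒ Y → Set (ℓ ⊔ e)
  IsIso {X} {Y} d = Σ (Y ⇒ X) λ d⁻¹ → (d ⨾ d⁻¹ ≈ id) × (d⁻¹ ⨾ d ≈ id)

  IsMoorePenroseInverse : ∀ {A B} → A ⇒ B → B ⇒ A → Set e
  IsMoorePenroseInverse f g =
    (f ⨾ g ⨾ f ≈ f) × (g ⨾ f ⨾ g ≈ g) ×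
    ((f ⨾ g) † ≈ f ⨾ g) × ((g ⨾ f) † ≈ g ⨾ f)

  †-Splits : ∀ {A} → A ⇒ A → Set (o ⊔ ℓ ⊔ e)
  †-Splits {A} ε = Σ Obj λ X → Σ (A ⇒ X) λ r → (r ⨾ r † ≈ ε) × (r † ⨾ r ≈ id)

  IsMoorePenroseSplit : ∀ {A B} → A ⇒ B → Set (o ⊔ ℓ ⊔ e)
  IsMoorePenroseSplit {A} {B} f =
    Σ (B ⇒ A) λ f° → IsMoorePenroseInverse f f° × †-Splits (f ⨾ f°) × †-Splits (f° ⨾ f)

  HasGCSVD : ∀ {A B} → A ⇒ B → Set (o ⊔ ℓ ⊔ e)
  HasGCSVD {A} {B} f =
    Σ Obj λ X → Σ Obj λ Y → Σ (A ⇒ X) λ r → Σ (X ⇒ Y) λ d → Σ (Y ⇒ B) λ s →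
      IsCoisometry r × IsIso d × IsIsometry s × (f ≈ r ⨾ d ⨾ s)

{-# OPTIONS --safe #-}
module Submission where

-- From an SVD f = r d s one reads off f° = s† d⁻¹ r†, and then f f° = r r† and f° f = s† s
-- are †-split by r and s†. Conversely, if f f° and f° f are †-split by r and t, then f is
-- the composite r (r† f t) t†, and the restriction r† f t of f between the splitting
-- objects is inverted by t† f° r.

open import Defs
open import Level using (Level)
open import Function.Bundles using (_⇔_; mk⇔)
open import Data.Product using (_,_)
open import Relation.Binary.Bundles using (Setoid)
open import Relation.Binary.Structures using (IsEquivalence)
import Relation.Binary.Reasoning.Setoid as SetoidReasoning

module Properties {o ℓ e : Level} (𝕏 : DaggerCategory o ℓ e) where
  open DaggerCategory 𝕏

  homSetoid : Obj → Obj → Setoid ℓ e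
  homSetoid A B = record { isEquivalence = ≈-equiv {A} {B} }

  module _ {A B : Obj} where
    open IsEquivalence (≈-equiv {A} {B}) public using (refl; sym; trans)
    open SetoidReasoning (homSetoid A B) public

  ⨾-congˡ : ∀ {A B C} {f : A ⇒ B} {g g' : B ⇒ C} → g ≈ g' → f ⨾ g ≈ f ⨾ g'
  ⨾-congˡ = ⨾-resp-≈ refl

  ⨾-congʳ : ∀ {A B C} {f f' : A ⇒ B} {g : B ⇒ C} → f ≈ f' → f ⨾ g ≈ f' ⨾ g
  ⨾-congʳ p = ⨾-resp-≈ p refl

  assoc-inner : ∀ {A B C D E} {x : A ⇒ B} {y : B ⇒ C} {z : C ⇒ D} {w : D ⇒ E} →
                (x ⨾ y) ⨾ (z ⨾ w) ≈ x ⨾ ((y ⨾ z) ⨾ w)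
  assoc-inner = trans assoc (⨾-congˡ (sym assoc))

  cancel-inner : ∀ {A B C D} {x : A ⇒ B} {y : B ⇒ C} {z : C ⇒ B} {w : B ⇒ D} →
                 y ⨾ z ≈ id → (x ⨾ y) ⨾ (z ⨾ w) ≈ x ⨾ w
  cancel-inner {x = x} {y} {z} {w} yz≈id = begin
    (x ⨾ y) ⨾ (z ⨾ w)   ≈⟨ assoc-inner ⟩
    x ⨾ ((y ⨾ z) ⨾ w)   ≈⟨ ⨾-congˡ (⨾-congʳ yz≈id) ⟩
    x ⨾ (id ⨾ w)        ≈⟨ ⨾-congˡ identityˡ ⟩
    x ⨾ w               ∎

  cancel-inner₂ : ∀ {A B C D E} {x : A ⇒ B} {p : B ⇒ C} {q : C ⇒ D}
                  {q' : D ⇒ C} {p' : C ⇒ B} {y : B ⇒ E} →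
                  q ⨾ q' ≈ id → p ⨾ p' ≈ id → (x ⨾ p ⨾ q) ⨾ (q' ⨾ p' ⨾ y) ≈ x ⨾ y
  cancel-inner₂ {x = x} {p} {q} {q'} {p'} {y} qq'≈id pp'≈id = begin
    (x ⨾ p ⨾ q) ⨾ (q' ⨾ p' ⨾ y)   ≈⟨ ⨾-congˡ assoc ⟩
    (x ⨾ p ⨾ q) ⨾ (q' ⨾ (p' ⨾ y)) ≈⟨ cancel-inner qq'≈id ⟩
    (x ⨾ p) ⨾ (p' ⨾ y)            ≈⟨ cancel-inner pp'≈id ⟩
    x ⨾ y                         ∎

  reassoc-sandwich : ∀ {A B C D E F} {x : A ⇒ B} {y : B ⇒ C} {a : C ⇒ D} {z : D ⇒ E} {w : E ⇒ F} →
                     x ⨾ (y ⨾ a ⨾ z) ⨾ w ≈ (x ⨾ y ⨾ a) ⨾ (z ⨾ w)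
  reassoc-sandwich = trans (⨾-congʳ (sym assoc)) (trans assoc (⨾-congʳ (sym assoc)))

  SelfAdjoint : ∀ {A} → A ⇒ A → Set e
  SelfAdjoint x = x † ≈ x

  ⨾†-selfAdjoint : ∀ {A X} (r : A ⇒ X) → SelfAdjoint (r ⨾ r †)
  ⨾†-selfAdjoint r = trans †-homomorphism (⨾-congʳ †-involutive)

  †-Splits⇒selfAdjoint : ∀ {A} {ε : A ⇒ A} → †-Splits 𝕏 ε → SelfAdjoint ε
  †-Splits⇒selfAdjoint (_ , r , rr†≈ε , _) =
    trans (†-resp-≈ (sym rr†≈ε)) (trans (⨾†-selfAdjoint r) rr†≈ε)

  isometry⇒†-coisometry : ∀ {A B} {s : A ⇒ B} → IsIsometry 𝕏 s → IsCoisometry 𝕏 (s †)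
  isometry⇒†-coisometry = trans (⨾-congʳ †-involutive)

  coisometry⇒†-isometry : ∀ {A B} {r : A ⇒ B} → IsCoisometry 𝕏 r → IsIsometry 𝕏 (r †)
  coisometry⇒†-isometry = trans (⨾-congˡ †-involutive)

  coisometry-†-splits : ∀ {A X} {ε : A ⇒ A} {r : A ⇒ X} →
                        IsCoisometry 𝕏 r → r ⨾ r † ≈ ε → †-Splits 𝕏 ε
  coisometry-†-splits {X = X} {r = r} r†r≈id rr†≈ε = X , r , rr†≈ε , r†r≈id

  restriction-inverse : ∀ {A B X Y} {f : A ⇒ B} {g : B ⇒ A} {r : A ⇒ X} {t : B ⇒ Y} →
                        g ⨾ f ⨾ g ≈ g → r ⨾ r † ≈ f ⨾ g → r † ⨾ r ≈ id → t ⨾ t † ≈ g ⨾ f →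
                        (r † ⨾ f ⨾ t) ⨾ (t † ⨾ g ⨾ r) ≈ id
  restriction-inverse {f = f} {g} {r} {t} gfg≈g rr†≈fg r†r≈id tt†≈gf = begin
    (r † ⨾ f ⨾ t) ⨾ (t † ⨾ g ⨾ r)     ≈⟨ assoc-inner ⟩
    (r † ⨾ f) ⨾ ((t ⨾ (t † ⨾ g)) ⨾ r) ≈⟨ ⨾-congˡ (⨾-congʳ (sym assoc)) ⟩
    (r † ⨾ f) ⨾ ((t ⨾ t †) ⨾ g ⨾ r)   ≈⟨ ⨾-congˡ (⨾-congʳ (trans (⨾-congʳ tt†≈gf) gfg≈g)) ⟩
    (r † ⨾ f) ⨾ (g ⨾ r)               ≈⟨ assoc-inner ⟩
    r † ⨾ ((f ⨾ g) ⨾ r)               ≈⟨ ⨾-congˡ (⨾-congʳ (sym rr†≈fg)) ⟩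
    r † ⨾ (r ⨾ r † ⨾ r)               ≈⟨ sym assoc ⟩
    (r † ⨾ (r ⨾ r †)) ⨾ r             ≈⟨ ⨾-congʳ (sym assoc) ⟩
    (r † ⨾ r) ⨾ r † ⨾ r               ≈⟨ ⨾-congʳ (trans (⨾-congʳ r†r≈id) identityˡ) ⟩
    r † ⨾ r                           ≈⟨ r†r≈id ⟩
    id                                ∎

  svd⇒moorePenroseSplit : ∀ {A B} {f : A ⇒ B} → HasGCSVD 𝕏 f → IsMoorePenroseSplit 𝕏 f
  svd⇒moorePenroseSplit {A} {B} {f}
    (_ , _ , r , d , s , r†r≈id , (d⁻¹ , dd⁻¹≈id , d⁻¹d≈id) , ss†≈id , f≈rds) =
    f° , (ff°f≈f , f°ff°≈f° , †-Splits⇒selfAdjoint ff°-splits , †-Splits⇒selfAdjoint f°f-splits) ,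
    ff°-splits , f°f-splits
    where
    f° : B ⇒ A
    f° = s † ⨾ d⁻¹ ⨾ r †
    ff°≈rr† : f ⨾ f° ≈ r ⨾ r †
    ff°≈rr† = trans (⨾-congʳ f≈rds) (cancel-inner₂ ss†≈id dd⁻¹≈id)
    f°f≈s†s : f° ⨾ f ≈ s † ⨾ s
    f°f≈s†s = trans (⨾-congˡ f≈rds) (cancel-inner₂ r†r≈id d⁻¹d≈id)
    ff°-splits : †-Splits 𝕏 (f ⨾ f°)
    ff°-splits = coisometry-†-splits r†r≈id (sym ff°≈rr†)
    f°f-splits : †-Splits 𝕏 (f° ⨾ f)
    f°f-splits = coisometry-†-splits (isometry⇒†-coisometry ss†≈id)
                   (trans (⨾-congˡ †-involutive) (sym f°f≈s†s))
    ff°f≈f : f ⨾ f° ⨾ f ≈ f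
    ff°f≈f = begin
      f ⨾ f° ⨾ f              ≈⟨ trans assoc (⨾-resp-≈ f≈rds f°f≈s†s) ⟩
      (r ⨾ d ⨾ s) ⨾ (s † ⨾ s) ≈⟨ cancel-inner ss†≈id ⟩
      r ⨾ d ⨾ s               ≈⟨ sym f≈rds ⟩
      f                       ∎
    f°ff°≈f° : f° ⨾ f ⨾ f° ≈ f°
    f°ff°≈f° = begin
      f° ⨾ f ⨾ f°                     ≈⟨ ⨾-resp-≈ f°f≈s†s assoc ⟩
      (s † ⨾ s) ⨾ (s † ⨾ (d⁻¹ ⨾ r †)) ≈⟨ cancel-inner ss†≈id ⟩
      s † ⨾ (d⁻¹ ⨾ r †)               ≈⟨ sym assoc ⟩
      f°                              ∎

  moorePenroseSplit⇒svd : ∀ {A B} {f : A ⇒ B} → IsMoorePenroseSplit 𝕏 f → HasGCSVD 𝕏 f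
  moorePenroseSplit⇒svd {f = f}
    (f° , (ff°f≈f , f°ff°≈f° , _ , _) , (X , r , rr†≈ff° , r†r≈id) , (Y , t , tt†≈f°f , t†t≈id)) =
    X , Y , r , r † ⨾ f ⨾ t , t † ,
    r†r≈id ,
    (t † ⨾ f° ⨾ r , restriction-inverse f°ff°≈f° rr†≈ff° r†r≈id tt†≈f°f ,
                    restriction-inverse ff°f≈f tt†≈f°f t†t≈id rr†≈ff°) ,
    coisometry⇒†-isometry t†t≈id ,
    sym (begin
      r ⨾ (r † ⨾ f ⨾ t) ⨾ t †   ≈⟨ reassoc-sandwich ⟩
      (r ⨾ r † ⨾ f) ⨾ (t ⨾ t †) ≈⟨ ⨾-resp-≈ (⨾-congʳ rr†≈ff°) tt†≈f°f ⟩
      (f ⨾ f° ⨾ f) ⨾ (f° ⨾ f)   ≈⟨ trans (⨾-congʳ ff°f≈f) (sym assoc) ⟩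
      f ⨾ f° ⨾ f                ≈⟨ ff°f≈f ⟩
      f                         ∎)

mainTheorem3 : ∀ {o ℓ e : Level} (𝕏 : DaggerCategory o ℓ e) →
               let open DaggerCategory 𝕏 in
               ∀ {A B : Obj} (f : A ⇒ B) → HasGCSVD 𝕏 f ⇔ IsMoorePenroseSplit 𝕏 f
mainTheorem3 𝕏 f = mk⇔ svd⇒moorePenroseSplit moorePenroseSplit⇒svd
  where open Properties 𝕏
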